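{- In $\widehat{\mathcal{Q}}$ one has \[\zeta_{\widehat{\mathcal{Q}}}(1)-\frac{\boldsymbol{p}-1}{2}(1-q)+\frac12\sum_{l\ge1}[\boldsymbol{p}]^l\,\overline{\zeta}_{\widehat{\mathcal{Q}}}(1+l)=0.\]
   Context: Let $[n]=[n]_q=(1-q^n)/(1-q)$. For a prime $p$, $\mathbb{Z}_{(p)}$ denotes the rationals whose denominator is prime to $p$. Set $Z_{p,n}=\mathbb{Z}_{(p)}[q]/([p]^n)$, $\mathcal{Q}_n=(\prod_pZ_{p,n})/(\bigoplus_pZ_{p,n})$ and $\widehat{\mathcal{Q}}=\varprojlim_n\mathcal{Q}_n$, which is a $\mathbb{Q}[q]$-algebra via the diagonal embedding. For $1\le m<p$, $[m]$ is invertible in $Z_{p,n}$. Put $\boldsymbol{p}=((p\bmod[p]^n)_p)_n$ and $[\boldsymbol{p}]=(([p]\bmod[p]^n)_p)_n$; the ring $\widehat{\mathcal{Q}}$ is complete in the $[\boldsymbol{p}]$-adic topology. For positive integers $k$ set \[\zeta_{\widehat{\mathcal{Q}}}(k)=\Big(\Big(\sum_{m=1}^{p-1}\frac{q^{(k-1)m}}{[m]^k}\bmod[p]^n\Big)_p\Big)_n,\qquad \overline{\zeta}_{\widehat{\mathcal{Q}}}(k)=\Big(\Big(\sum_{m=1}^{p-1}\frac{q^m}{[m]^k}\bmod[p]^n\Big)_p\Big)_n.\] -}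

module Defs where

open import Data.Nat as ℕ using (ℕ; zero; suc; _∸_)
open import Data.Nat.Divisibility using (_∣_)
open import Data.Integer using (+_)
open import Data.Rational as ℚ using (ℚ; 0ℚ; 1ℚ; ½; _/_)
open import Data.List using (List; []; _∷_; replicate)
open import Data.Product using (∃; _×_)
open import Relation.Nullary using (¬_)
open import Relation.Binary.PropositionalEquality using (_≡_)

-- Polynomials in q with rational coefficients, as coefficient lists
-- (lowest degree first).  Equality of polynomials is coefficientwise.

Poly : Set
Poly = List ℚ

coeff : Poly → ℕ → ℚ
coeff []       _       = 0ℚ
coeff (a ∷ _)  zero    = a
coeff (_ ∷ f)  (suc i) = coeff f i

infix 4 _≈ₚ_
_≈ₚ_ : Poly → Poly → Set
f ≈ₚ g = ∀ i → coeff f i ≡ coeff g i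

infixl 6 _+ₚ_ _-ₚ_
infixl 7 _*ₚ_ _·ₚ_

_+ₚ_ : Poly → Poly → Poly
[]      +ₚ g       = g
f       +ₚ []      = f
(a ∷ f) +ₚ (b ∷ g) = (a ℚ.+ b) ∷ (f +ₚ g)

_·ₚ_ : ℚ → Poly → Poly
c ·ₚ []      = []
c ·ₚ (a ∷ f) = (c ℚ.* a) ∷ (c ·ₚ f)

-ₚ_ : Poly → Poly
-ₚ f = (ℚ.- 1ℚ) ·ₚ f

_-ₚ_ : Poly → Poly → Poly
f -ₚ g = f +ₚ (-ₚ g)

_*ₚ_ : Poly → Poly → Poly
[]      *ₚ g = []
(a ∷ f) *ₚ g = (a ·ₚ g) +ₚ (0ℚ ∷ (f *ₚ g))

constₚ : ℚ → Poly
constₚ c = c ∷ []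

oneₚ : Poly
oneₚ = constₚ 1ℚ

qₚ : Poly
qₚ = 0ℚ ∷ 1ℚ ∷ []

infixr 8 _^ₚ_
_^ₚ_ : Poly → ℕ → Poly
f ^ₚ zero    = oneₚ
f ^ₚ (suc k) = f *ₚ (f ^ₚ k)

ℕ→ℚ : ℕ → ℚ
ℕ→ℚ n = (+ n) / 1

-- the q-integer [n] = (1 - q^n)/(1 - q) = 1 + q + ... + q^(n-1)
[_]q : ℕ → Poly
[ n ]q = replicate n 1ℚ

sum1 : (ℕ → Poly) → ℕ → Poly
sum1 f zero    = []
sum1 f (suc N) = sum1 f N +ₚ f (suc N)

InZ₍ₚ₎ : ℕ → ℚ → Set
InZ₍ₚ₎ p x = ¬ (p ∣ ℚ.denominatorℕ x)

InZ₍ₚ₎[q] : ℕ → Poly → Set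
InZ₍ₚ₎[q] p f = ∀ i → InZ₍ₚ₎ p (coeff f i)

CongZ : (p n : ℕ) → Poly → Poly → Set
CongZ p n f g = ∃ λ c → InZ₍ₚ₎[q] p c × (f -ₚ g ≈ₚ ([ p ]q ^ₚ n) *ₚ c)

IsInvFamily : (p n : ℕ) → (ℕ → Poly) → Set
IsInvFamily p n inv =
  ∀ m → 1 ℕ.≤ m → m ℕ.< p →
    InZ₍ₚ₎[q] p (inv m) × CongZ p n (inv m *ₚ [ m ]q) oneₚ

-- p-components of the elements in the statement, given inverses inv m of [m]

ζₚ : (p k : ℕ) → (ℕ → Poly) → Poly
ζₚ p k inv = sum1 (λ m → (qₚ ^ₚ ((k ∸ 1) ℕ.* m)) *ₚ (inv m ^ₚ k)) (p ∸ 1)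

ζbarₚ : (p k : ℕ) → (ℕ → Poly) → Poly
ζbarₚ p k inv = sum1 (λ m → (qₚ ^ₚ m) *ₚ (inv m ^ₚ k)) (p ∸ 1)

tailSumₚ : (p L : ℕ) → (ℕ → Poly) → Poly
tailSumₚ p L inv = sum1 (λ l → ([ p ]q ^ₚ l) *ₚ ζbarₚ p (1 ℕ.+ l) inv) L

LHSₚ : (p L : ℕ) → (ℕ → Poly) → Poly
LHSₚ p L inv =
  ζₚ p 1 inv
  -ₚ ((ℕ→ℚ (p ∸ 1) ℚ.* ½) ·ₚ (oneₚ -ₚ qₚ))
  +ₚ (½ ·ₚ tailSumₚ p L inv)

zeroₚ : Poly
zeroₚ = []

-- For 1 ≤ m < p write [p] = [m] + q^m [p - m]. Since [p]^(L+1) ≡ 0 modulo [p]ⁿ when L ≥ n,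
-- the geometric series inverting 1 - [p]/[m] may be truncated, and
--   1/[p - m] = -(q^m/[m]) / (1 - [p]/[m]) ≡ -q^m Σ_{l=0}^{L} [p]^l / [m]^(l+1).
-- Together with (1 - q^m)/[m] = 1 - q this gives
--   1/[m] + 1/[p - m] ≡ (1 - q) - q^m Σ_{l=1}^{L} [p]^l / [m]^(l+1).
-- Summed over m, the left side is 2ζ(1), because m ↦ p - m permutes the terms, and the right side
-- is (p - 1)(1 - q) - Σ_l [p]^l ζ̄(1+l). Halving, which needs p > 2, gives the claim.

module Submission where

open import Data.Nat as ℕ using (ℕ; zero; suc; _∸_; _≤_; _<_; z≤n; s≤s)
import Data.Nat.Properties as ℕ
open import Data.Nat.Divisibility using (_∣_; _∤_; divides; ∣-trans; >⇒∤)
open import Data.Nat.Primality using (Prime; euclidsLemma; prime⇒nonTrivial)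
open import Data.Integer as ℤ using (+_)
import Data.Integer.Properties as ℤ
open import Data.Rational as ℚ using (0ℚ; 1ℚ; ½; ↧_; ↧ₙ_)
import Data.Rational.Properties as ℚ
import Data.Rational.Unnormalised as ℚᵘ
import Data.Rational.Unnormalised.Properties as ℚᵘ
open import Data.List using ([]; _∷_)
open import Data.Maybe using (Maybe; just; nothing)
open import Relation.Nullary using (yes; no)
open import Data.Product using (∃; _×_; _,_; proj₁; proj₂)
open import Data.Sum using (inj₁; inj₂)
open import Algebra.Bundles using (CommutativeMonoid; CommutativeRing)
import Algebra.Properties.CommutativeSemigroup as CommutativeSemigroupProperties
open import Relation.Binary.Structures using (IsEquivalence)
open import Relation.Binary.Bundles using (Setoid)
open import Relation.Binary.PropositionalEquality using (_≡_; refl; sym; trans; cong; cong₂; subst; module ≡-Reasoning)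
import Relation.Binary.Reasoning.Setoid
open import Algebra.Solver.Ring.AlmostCommutativeRing using (fromCommutativeRing; _-Raw-AlmostCommutative⟶_)
import Algebra.Solver.Ring

open import Defs

-- p-integral rationals

↧ₙ-∣ : ∀ r g m → ↧ r ℤ.* g ≡ + m → ↧ₙ r ∣ m
↧ₙ-∣ r g m eq = divides ℤ.∣ g ∣ (begin
  m                          ≡⟨ cong ℤ.∣_∣ (sym eq) ⟩
  ℤ.∣ ↧ r ℤ.* g ∣            ≡⟨ ℤ.abs-* (↧ r) g ⟩
  ↧ₙ r ℕ.* ℤ.∣ g ∣           ≡⟨ ℕ.*-comm (↧ₙ r) _ ⟩
  ℤ.∣ g ∣ ℕ.* ↧ₙ r           ∎)
  where open ≡-Reasoning

module _ {p : ℕ} (p-prime : Prime p) where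

  ∤-* : ∀ {a b} → p ∤ a → p ∤ b → p ∤ a ℕ.* b
  ∤-* {a} {b} p∤a p∤b p∣ab with euclidsLemma a b p-prime p∣ab
  ... | inj₁ p∣a = p∤a p∣a
  ... | inj₂ p∣b = p∤b p∣b

  InZ₍ₚ₎-+ : ∀ {a b} → InZ₍ₚ₎ p a → InZ₍ₚ₎ p b → InZ₍ₚ₎ p (a ℚ.+ b)
  InZ₍ₚ₎-+ {a} {b} za zb p∣ = ∤-* za zb (∣-trans p∣ (↧ₙ-∣ (a ℚ.+ b) _ _
    (trans (ℚ.↧-+ a b) (sym (ℤ.pos-* (↧ₙ a) (↧ₙ b))))))

  InZ₍ₚ₎-* : ∀ {a b} → InZ₍ₚ₎ p a → InZ₍ₚ₎ p b → InZ₍ₚ₎ p (a ℚ.* b)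
  InZ₍ₚ₎-* {a} {b} za zb p∣ = ∤-* za zb (∣-trans p∣ (↧ₙ-∣ (a ℚ.* b) _ _
    (trans (ℚ.↧-* a b) (sym (ℤ.pos-* (↧ₙ a) (↧ₙ b))))))

  -- p-integrality of 0ℚ, 1ℚ and ℚ.- 1ℚ, whose denominators are all 1.
  p∤1 : p ∤ 1
  p∤1 = >⇒∤ (ℕ.nonTrivial⇒n>1 p {{prime⇒nonTrivial p-prime}})

InZ₍ₚ₎-½ : ∀ {p} → 2 < p → InZ₍ₚ₎ p ½
InZ₍ₚ₎-½ = >⇒∤

-- The ring ℚ[q]

-- Coefficientwise equality wrapped in a record, so that its two sides can be inferred.
infix 4 _≋_
record _≋_ (f g : Poly) : Set where
  constructor mk≋
  field coeff-≡ : f ≈ₚ g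
open _≋_

≋-refl : ∀ {f} → f ≋ f
≋-refl = mk≋ λ _ → refl

≋-sym : ∀ {f g} → f ≋ g → g ≋ f
≋-sym (mk≋ e) = mk≋ λ i → sym (e i)

≋-trans : ∀ {f g h} → f ≋ g → g ≋ h → f ≋ h
≋-trans (mk≋ e) (mk≋ e′) = mk≋ λ i → trans (e i) (e′ i)

≋-isEquivalence : IsEquivalence _≋_
≋-isEquivalence = record { refl = ≋-refl ; sym = ≋-sym ; trans = ≋-trans }

≡⇒≋ : ∀ {f g} → f ≡ g → f ≋ g
≡⇒≋ refl = ≋-refl

∷-cong : ∀ {a b f g} → a ≡ b → f ≋ g → a ∷ f ≋ b ∷ g
∷-cong a≡b (mk≋ e) = mk≋ λ { zero → a≡b ; (suc i) → e i }

∷-injective : ∀ {a b f g} → a ∷ f ≋ b ∷ g → a ≡ b × f ≋ g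
∷-injective (mk≋ e) = e zero , mk≋ λ i → e (suc i)

∷≋[] : ∀ {a f} → a ∷ f ≋ [] → a ≡ 0ℚ × f ≋ []
∷≋[] (mk≋ e) = e zero , mk≋ λ i → e (suc i)

0∷[]≋[] : 0ℚ ∷ [] ≋ []
0∷[]≋[] = mk≋ λ { zero → refl ; (suc i) → refl }

coeff-+ₚ : ∀ f g i → coeff (f +ₚ g) i ≡ coeff f i ℚ.+ coeff g i
coeff-+ₚ []      g       i       = sym (ℚ.+-identityˡ _)
coeff-+ₚ (a ∷ f) []      i       = sym (ℚ.+-identityʳ _)
coeff-+ₚ (a ∷ f) (b ∷ g) zero    = refl
coeff-+ₚ (a ∷ f) (b ∷ g) (suc i) = coeff-+ₚ f g i

coeff-·ₚ : ∀ c f i → coeff (c ·ₚ f) i ≡ c ℚ.* coeff f i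
coeff-·ₚ c []      i       = sym (ℚ.*-zeroʳ c)
coeff-·ₚ c (a ∷ f) zero    = refl
coeff-·ₚ c (a ∷ f) (suc i) = coeff-·ₚ c f i

+ₚ-cong : ∀ {f f′ g g′} → f ≋ f′ → g ≋ g′ → f +ₚ g ≋ f′ +ₚ g′
+ₚ-cong {f} {f′} {g} {g′} (mk≋ e) (mk≋ e′) = mk≋ λ i →
  trans (coeff-+ₚ f g i) (trans (cong₂ ℚ._+_ (e i) (e′ i)) (sym (coeff-+ₚ f′ g′ i)))

·ₚ-cong : ∀ {c d f g} → c ≡ d → f ≋ g → c ·ₚ f ≋ d ·ₚ g
·ₚ-cong {c} {d} {f} {g} c≡d (mk≋ e) = mk≋ λ i →
  trans (coeff-·ₚ c f i) (trans (cong₂ ℚ._*_ c≡d (e i)) (sym (coeff-·ₚ d g i)))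

-ₚ‿cong : ∀ {f g} → f ≋ g → -ₚ f ≋ -ₚ g
-ₚ‿cong = ·ₚ-cong refl

+ₚ-comm : ∀ f g → f +ₚ g ≋ g +ₚ f
+ₚ-comm f g = mk≋ λ i → begin
  coeff (f +ₚ g) i          ≡⟨ coeff-+ₚ f g i ⟩
  coeff f i ℚ.+ coeff g i   ≡⟨ ℚ.+-comm (coeff f i) (coeff g i) ⟩
  coeff g i ℚ.+ coeff f i   ≡⟨ coeff-+ₚ g f i ⟨
  coeff (g +ₚ f) i          ∎
  where open ≡-Reasoning

+ₚ-assoc : ∀ f g h → (f +ₚ g) +ₚ h ≋ f +ₚ (g +ₚ h)
+ₚ-assoc f g h = mk≋ λ i → begin
  coeff ((f +ₚ g) +ₚ h) i                    ≡⟨ coeff-+ₚ (f +ₚ g) h i ⟩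
  coeff (f +ₚ g) i ℚ.+ coeff h i             ≡⟨ cong (ℚ._+ coeff h i) (coeff-+ₚ f g i) ⟩
  (coeff f i ℚ.+ coeff g i) ℚ.+ coeff h i    ≡⟨ ℚ.+-assoc (coeff f i) (coeff g i) (coeff h i) ⟩
  coeff f i ℚ.+ (coeff g i ℚ.+ coeff h i)    ≡⟨ cong (coeff f i ℚ.+_) (coeff-+ₚ g h i) ⟨
  coeff f i ℚ.+ coeff (g +ₚ h) i             ≡⟨ coeff-+ₚ f (g +ₚ h) i ⟨
  coeff (f +ₚ (g +ₚ h)) i                    ∎
  where open ≡-Reasoning

+ₚ-identityʳ : ∀ f → f +ₚ [] ≋ f
+ₚ-identityʳ []      = ≋-refl
+ₚ-identityʳ (a ∷ f) = ≋-refl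

-ₚ‿inverseʳ : ∀ f → f -ₚ f ≋ []
-ₚ‿inverseʳ f = mk≋ λ i → begin
  coeff (f -ₚ f) i                        ≡⟨ coeff-+ₚ f (-ₚ f) i ⟩
  coeff f i ℚ.+ coeff (-ₚ f) i            ≡⟨ cong (coeff f i ℚ.+_) (coeff-·ₚ (ℚ.- 1ℚ) f i) ⟩
  coeff f i ℚ.+ (ℚ.- 1ℚ) ℚ.* coeff f i    ≡⟨ cong (coeff f i ℚ.+_) (ℚ.neg-distribˡ-* 1ℚ (coeff f i)) ⟨
  coeff f i ℚ.+ ℚ.- (1ℚ ℚ.* coeff f i)    ≡⟨ cong (λ a → coeff f i ℚ.+ ℚ.- a) (ℚ.*-identityˡ (coeff f i)) ⟩
  coeff f i ℚ.+ ℚ.- coeff f i             ≡⟨ ℚ.+-inverseʳ (coeff f i) ⟩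
  0ℚ                                      ∎
  where open ≡-Reasoning

-ₚ‿inverseˡ : ∀ f → (-ₚ f) +ₚ f ≋ []
-ₚ‿inverseˡ f = ≋-trans (+ₚ-comm (-ₚ f) f) (-ₚ‿inverseʳ f)

·ₚ-distribˡ : ∀ c f g → c ·ₚ (f +ₚ g) ≋ c ·ₚ f +ₚ c ·ₚ g
·ₚ-distribˡ c f g = mk≋ λ i → begin
  coeff (c ·ₚ (f +ₚ g)) i                       ≡⟨ coeff-·ₚ c (f +ₚ g) i ⟩
  c ℚ.* coeff (f +ₚ g) i                        ≡⟨ cong (c ℚ.*_) (coeff-+ₚ f g i) ⟩
  c ℚ.* (coeff f i ℚ.+ coeff g i)               ≡⟨ ℚ.*-distribˡ-+ c _ _ ⟩
  c ℚ.* coeff f i ℚ.+ c ℚ.* coeff g i           ≡⟨ cong₂ ℚ._+_ (coeff-·ₚ c f i) (coeff-·ₚ c g i) ⟨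
  coeff (c ·ₚ f) i ℚ.+ coeff (c ·ₚ g) i         ≡⟨ coeff-+ₚ (c ·ₚ f) (c ·ₚ g) i ⟨
  coeff (c ·ₚ f +ₚ c ·ₚ g) i                    ∎
  where open ≡-Reasoning

·ₚ-distribʳ : ∀ c d f → (c ℚ.+ d) ·ₚ f ≋ c ·ₚ f +ₚ d ·ₚ f
·ₚ-distribʳ c d f = mk≋ λ i → begin
  coeff ((c ℚ.+ d) ·ₚ f) i                      ≡⟨ coeff-·ₚ (c ℚ.+ d) f i ⟩
  (c ℚ.+ d) ℚ.* coeff f i                       ≡⟨ ℚ.*-distribʳ-+ (coeff f i) c d ⟩
  c ℚ.* coeff f i ℚ.+ d ℚ.* coeff f i           ≡⟨ cong₂ ℚ._+_ (coeff-·ₚ c f i) (coeff-·ₚ d f i) ⟨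
  coeff (c ·ₚ f) i ℚ.+ coeff (d ·ₚ f) i         ≡⟨ coeff-+ₚ (c ·ₚ f) (d ·ₚ f) i ⟨
  coeff (c ·ₚ f +ₚ d ·ₚ f) i                    ∎
  where open ≡-Reasoning

·ₚ-assoc : ∀ c d f → c ·ₚ (d ·ₚ f) ≋ (c ℚ.* d) ·ₚ f
·ₚ-assoc c d f = mk≋ λ i → begin
  coeff (c ·ₚ (d ·ₚ f)) i      ≡⟨ coeff-·ₚ c (d ·ₚ f) i ⟩
  c ℚ.* coeff (d ·ₚ f) i       ≡⟨ cong (c ℚ.*_) (coeff-·ₚ d f i) ⟩
  c ℚ.* (d ℚ.* coeff f i)      ≡⟨ ℚ.*-assoc c d _ ⟨
  (c ℚ.* d) ℚ.* coeff f i      ≡⟨ coeff-·ₚ (c ℚ.* d) f i ⟨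
  coeff ((c ℚ.* d) ·ₚ f) i     ∎
  where open ≡-Reasoning

0·ₚ : ∀ f → 0ℚ ·ₚ f ≋ []
0·ₚ f = mk≋ λ i → trans (coeff-·ₚ 0ℚ f i) (ℚ.*-zeroˡ (coeff f i))

1·ₚ : ∀ f → 1ℚ ·ₚ f ≋ f
1·ₚ f = mk≋ λ i → trans (coeff-·ₚ 1ℚ f i) (ℚ.*-identityˡ (coeff f i))

+ₚ-interchange : ∀ w x y z → (w +ₚ x) +ₚ (y +ₚ z) ≋ (w +ₚ y) +ₚ (x +ₚ z)
+ₚ-interchange w x y z = mk≋ λ i → begin
  coeff ((w +ₚ x) +ₚ (y +ₚ z)) i
    ≡⟨ coeff-+ₚ (w +ₚ x) (y +ₚ z) i ⟩
  coeff (w +ₚ x) i ℚ.+ coeff (y +ₚ z) i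
    ≡⟨ cong₂ ℚ._+_ (coeff-+ₚ w x i) (coeff-+ₚ y z i) ⟩
  (coeff w i ℚ.+ coeff x i) ℚ.+ (coeff y i ℚ.+ coeff z i)
    ≡⟨ +-interchange (coeff w i) (coeff x i) (coeff y i) (coeff z i) ⟩
  (coeff w i ℚ.+ coeff y i) ℚ.+ (coeff x i ℚ.+ coeff z i)
    ≡⟨ cong₂ ℚ._+_ (coeff-+ₚ w y i) (coeff-+ₚ x z i) ⟨
  coeff (w +ₚ y) i ℚ.+ coeff (x +ₚ z) i
    ≡⟨ coeff-+ₚ (w +ₚ y) (x +ₚ z) i ⟨
  coeff ((w +ₚ y) +ₚ (x +ₚ z)) i
    ∎
  where
  open ≡-Reasoning
  open CommutativeSemigroupProperties (CommutativeMonoid.commutativeSemigroup ℚ.+-0-commutativeMonoid)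
    renaming (interchange to +-interchange)

+ₚ-swap : ∀ x y z → x +ₚ (y +ₚ z) ≋ y +ₚ (x +ₚ z)
+ₚ-swap x y z = ≋-trans (≋-sym (+ₚ-assoc x y z)) (≋-trans (+ₚ-cong (+ₚ-comm x y) ≋-refl) (+ₚ-assoc y x z))

*ₚ-zeroʳ : ∀ f → f *ₚ [] ≋ []
*ₚ-zeroʳ []      = ≋-refl
*ₚ-zeroʳ (a ∷ f) = ≋-trans (∷-cong refl (*ₚ-zeroʳ f)) 0∷[]≋[]

*ₚ-zero-congˡ : ∀ {f} g → f ≋ [] → f *ₚ g ≋ []
*ₚ-zero-congˡ {[]}    g f≋[] = ≋-refl
*ₚ-zero-congˡ {a ∷ f} g f≋[] with ∷≋[] f≋[]
... | refl , f≋[]′ = ≋-trans (+ₚ-cong (0·ₚ g) (∷-cong refl (*ₚ-zero-congˡ g f≋[]′))) 0∷[]≋[]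

*ₚ-congˡ : ∀ {f f′} g → f ≋ f′ → f *ₚ g ≋ f′ *ₚ g
*ₚ-congˡ {[]}    {[]}      g e = ≋-refl
*ₚ-congˡ {[]}    {a′ ∷ f′} g e = ≋-sym (*ₚ-zero-congˡ g (≋-sym e))
*ₚ-congˡ {a ∷ f} {[]}      g e = *ₚ-zero-congˡ g e
*ₚ-congˡ {a ∷ f} {a′ ∷ f′} g e with ∷-injective e
... | a≡a′ , f≋f′ = +ₚ-cong (·ₚ-cong a≡a′ (≋-refl {g})) (∷-cong refl (*ₚ-congˡ g f≋f′))

*ₚ-congʳ : ∀ f {g g′} → g ≋ g′ → f *ₚ g ≋ f *ₚ g′
*ₚ-congʳ []      e = ≋-refl
*ₚ-congʳ (a ∷ f) e = +ₚ-cong (·ₚ-cong refl e) (∷-cong refl (*ₚ-congʳ f e))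

*ₚ-cong : ∀ {f f′ g g′} → f ≋ f′ → g ≋ g′ → f *ₚ g ≋ f′ *ₚ g′
*ₚ-cong {f′ = f′} {g = g} e e′ = ≋-trans (*ₚ-congˡ g e) (*ₚ-congʳ f′ e′)

*ₚ-∷ʳ : ∀ f b g → f *ₚ (b ∷ g) ≋ b ·ₚ f +ₚ (0ℚ ∷ f *ₚ g)
*ₚ-∷ʳ []      b g = ≋-sym 0∷[]≋[]
*ₚ-∷ʳ (a ∷ f) b g = ∷-cong (cong (ℚ._+ 0ℚ) (ℚ.*-comm a b))
  (≋-trans (+ₚ-cong (≋-refl {a ·ₚ g}) (*ₚ-∷ʳ f b g)) (+ₚ-swap (a ·ₚ g) (b ·ₚ f) (0ℚ ∷ f *ₚ g)))

*ₚ-comm : ∀ f g → f *ₚ g ≋ g *ₚ f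
*ₚ-comm []      g = ≋-sym (*ₚ-zeroʳ g)
*ₚ-comm (a ∷ f) g = ≋-trans (+ₚ-cong (≋-refl {a ·ₚ g}) (∷-cong refl (*ₚ-comm f g))) (≋-sym (*ₚ-∷ʳ g a f))

*ₚ-distribʳ : ∀ h f g → (f +ₚ g) *ₚ h ≋ f *ₚ h +ₚ g *ₚ h
*ₚ-distribʳ h []      g       = ≋-refl
*ₚ-distribʳ h (a ∷ f) []      = ≋-sym (+ₚ-identityʳ _)
*ₚ-distribʳ h (a ∷ f) (b ∷ g) =
  ≋-trans (+ₚ-cong (·ₚ-distribʳ a b h) (∷-cong (sym (ℚ.+-identityʳ 0ℚ)) (*ₚ-distribʳ h f g)))
          (+ₚ-interchange (a ·ₚ h) (b ·ₚ h) (0ℚ ∷ f *ₚ h) (0ℚ ∷ g *ₚ h))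

*ₚ-distribˡ : ∀ h f g → h *ₚ (f +ₚ g) ≋ h *ₚ f +ₚ h *ₚ g
*ₚ-distribˡ h f g =
  ≋-trans (*ₚ-comm h (f +ₚ g)) (≋-trans (*ₚ-distribʳ h f g) (+ₚ-cong (*ₚ-comm f h) (*ₚ-comm g h)))

·ₚ-*ₚ : ∀ c f g → (c ·ₚ f) *ₚ g ≋ c ·ₚ (f *ₚ g)
·ₚ-*ₚ c []      g = ≋-refl
·ₚ-*ₚ c (a ∷ f) g =
  ≋-trans (+ₚ-cong (≋-sym (·ₚ-assoc c a g)) (∷-cong (sym (ℚ.*-zeroʳ c)) (·ₚ-*ₚ c f g)))
          (≋-sym (·ₚ-distribˡ c (a ·ₚ g) (0ℚ ∷ f *ₚ g)))

*ₚ-assoc : ∀ f g h → (f *ₚ g) *ₚ h ≋ f *ₚ (g *ₚ h)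
*ₚ-assoc []      g h = ≋-refl
*ₚ-assoc (a ∷ f) g h =
  ≋-trans (*ₚ-distribʳ h (a ·ₚ g) (0ℚ ∷ f *ₚ g))
          (+ₚ-cong (·ₚ-*ₚ a g h) (+ₚ-cong (0·ₚ h) (∷-cong refl (*ₚ-assoc f g h))))

*ₚ-identityˡ : ∀ f → oneₚ *ₚ f ≋ f
*ₚ-identityˡ f = ≋-trans (+ₚ-cong (1·ₚ f) 0∷[]≋[]) (+ₚ-identityʳ f)

*ₚ-identityʳ : ∀ f → f *ₚ oneₚ ≋ f
*ₚ-identityʳ f = ≋-trans (*ₚ-comm f oneₚ) (*ₚ-identityˡ f)

Poly-commutativeRing : CommutativeRing _ _
Poly-commutativeRing = record
  { Carrier = Poly ; _≈_ = _≋_ ; _+_ = _+ₚ_ ; _*_ = _*ₚ_ ; -_ = -ₚ_ ; 0# = [] ; 1# = oneₚ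
  ; isCommutativeRing = record
    { isRing = record
      { +-isAbelianGroup = record
        { isGroup = record
          { isMonoid = record
            { isSemigroup = record
              { isMagma = record { isEquivalence = ≋-isEquivalence ; ∙-cong = +ₚ-cong }
              ; assoc = +ₚ-assoc }
            ; identity = (λ _ → ≋-refl) , +ₚ-identityʳ }
          ; inverse = -ₚ‿inverseˡ , -ₚ‿inverseʳ
          ; ⁻¹-cong = -ₚ‿cong }
        ; comm = +ₚ-comm }
      ; *-cong = *ₚ-cong
      ; *-assoc = *ₚ-assoc
      ; *-identity = *ₚ-identityˡ , *ₚ-identityʳ
      ; distrib = *ₚ-distribˡ , *ₚ-distribʳ }
    ; *-comm = *ₚ-comm } }

const-* : ∀ a b → constₚ (a ℚ.* b) ≋ constₚ a *ₚ constₚ b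
const-* a b = ∷-cong (sym (ℚ.+-identityʳ (a ℚ.* b))) ≋-refl

·ₚ≋const*ₚ : ∀ c f → c ·ₚ f ≋ constₚ c *ₚ f
·ₚ≋const*ₚ c f = ≋-sym (≋-trans (+ₚ-cong (≋-refl {c ·ₚ f}) 0∷[]≋[]) (+ₚ-identityʳ (c ·ₚ f)))

const-homomorphism : ℚ.+-*-rawRing -Raw-AlmostCommutative⟶ fromCommutativeRing Poly-commutativeRing
const-homomorphism = record
  { ⟦_⟧    = constₚ
  ; +-homo = λ a b → ≋-refl
  ; *-homo = const-*
  ; -‿homo = λ a → ∷-cong (trans (cong ℚ.-_ (sym (ℚ.*-identityˡ a))) (ℚ.neg-distribˡ-* 1ℚ a)) ≋-refl
  ; 0-homo = 0∷[]≋[]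
  ; 1-homo = ≋-refl }

const-≟ : ∀ a b → Maybe (constₚ a ≋ constₚ b)
const-≟ a b with a ℚ.≟ b
... | yes refl = just ≋-refl
... | no _     = nothing

module PolySolver = Algebra.Solver.Ring ℚ.+-*-rawRing (fromCommutativeRing Poly-commutativeRing) const-homomorphism const-≟
open PolySolver using (solve; _:+_; _:*_; :-_; _:-_; _:=_; con)

module ≋-Reasoning = Relation.Binary.Reasoning.Setoid (CommutativeRing.setoid Poly-commutativeRing)

-- Finite sums

ℕ→ℚ-suc : ∀ n → ℕ→ℚ (suc n) ≡ ℕ→ℚ n ℚ.+ 1ℚ
ℕ→ℚ-suc n = ℚ.toℚᵘ-injective (begin
  ℚ.toℚᵘ (ℕ→ℚ (suc n))            ≈⟨ ℚ.toℚᵘ-fromℚᵘ (ℚᵘ.mkℚᵘ (+ suc n) 0) ⟩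
  ℚᵘ.mkℚᵘ (+ suc n) 0              ≈⟨ ℚᵘ.*≡* (cong (ℤ._* + 1) +suc) ⟩
  ℚᵘ.mkℚᵘ (+ n) 0 ℚᵘ.+ ℚᵘ.1ℚᵘ      ≈⟨ ℚᵘ.+-congˡ ℚᵘ.1ℚᵘ (ℚ.toℚᵘ-fromℚᵘ (ℚᵘ.mkℚᵘ (+ n) 0)) ⟨
  ℚ.toℚᵘ (ℕ→ℚ n) ℚᵘ.+ ℚ.toℚᵘ 1ℚ   ≈⟨ ℚ.toℚᵘ-homo-+ (ℕ→ℚ n) 1ℚ ⟨
  ℚ.toℚᵘ (ℕ→ℚ n ℚ.+ 1ℚ)           ∎)
  where
  open ℚᵘ.≃-Reasoning
  +suc : + suc n ≡ + n ℤ.* + 1 ℤ.+ + 1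
  +suc = trans (cong +_ (ℕ.+-comm 1 n))
         (trans (ℤ.pos-+ n 1) (cong (ℤ._+ + 1) (sym (ℤ.*-identityʳ (+ n)))))

sum1-cong : ∀ {f g : ℕ → Poly} N → (∀ m → 1 ≤ m → m ≤ N → f m ≋ g m) → sum1 f N ≋ sum1 g N
sum1-cong zero    f≋g = ≋-refl
sum1-cong (suc N) f≋g =
  +ₚ-cong (sum1-cong N (λ m 1≤m m≤N → f≋g m 1≤m (ℕ.m≤n⇒m≤1+n m≤N))) (f≋g (suc N) (s≤s z≤n) ℕ.≤-refl)

sum1-+ : ∀ (f g : ℕ → Poly) N → sum1 (λ m → f m +ₚ g m) N ≋ sum1 f N +ₚ sum1 g N
sum1-+ f g zero    = ≋-refl
sum1-+ f g (suc N) = ≋-trans (+ₚ-cong (sum1-+ f g N) ≋-refl)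
  (+ₚ-interchange (sum1 f N) (sum1 g N) (f (suc N)) (g (suc N)))

sum1-*ˡ : ∀ h (f : ℕ → Poly) N → sum1 (λ m → h *ₚ f m) N ≋ h *ₚ sum1 f N
sum1-*ˡ h f zero    = ≋-sym (*ₚ-zeroʳ h)
sum1-*ˡ h f (suc N) = ≋-trans (+ₚ-cong (sum1-*ˡ h f N) ≋-refl) (≋-sym (*ₚ-distribˡ h (sum1 f N) (f (suc N))))

sum1-const : ∀ g N → sum1 (λ _ → g) N ≋ ℕ→ℚ N ·ₚ g
sum1-const g zero    = ≋-sym (0·ₚ g)
sum1-const g (suc N) = begin
  sum1 (λ _ → g) N +ₚ g           ≈⟨ +ₚ-cong (sum1-const g N) (≋-sym (1·ₚ g)) ⟩
  ℕ→ℚ N ·ₚ g +ₚ 1ℚ ·ₚ g           ≈⟨ ·ₚ-distribʳ (ℕ→ℚ N) 1ℚ g ⟨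
  (ℕ→ℚ N ℚ.+ 1ℚ) ·ₚ g             ≈⟨ ·ₚ-cong (ℕ→ℚ-suc N) ≋-refl ⟨
  ℕ→ℚ (suc N) ·ₚ g                ∎
  where open ≋-Reasoning

sum1-swap : ∀ (F : ℕ → ℕ → Poly) L M →
  sum1 (λ l → sum1 (F l) M) L ≋ sum1 (λ m → sum1 (λ l → F l m) L) M
sum1-swap F zero    M = ≋-trans (≋-sym (0·ₚ [])) (≋-sym (sum1-const [] M))
sum1-swap F (suc L) M = ≋-trans (+ₚ-cong (sum1-swap F L M) ≋-refl)
  (≋-sym (sum1-+ (λ m → sum1 (λ l → F l m) L) (F (suc L)) M))

sum1-unconsˡ : ∀ (f : ℕ → Poly) N → sum1 f (suc N) ≋ f 1 +ₚ sum1 (λ m → f (suc m)) N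
sum1-unconsˡ f zero    = +ₚ-comm [] (f 1)
sum1-unconsˡ f (suc N) = ≋-trans (+ₚ-cong (sum1-unconsˡ f N) ≋-refl) (+ₚ-assoc (f 1) _ _)

sum1-reverse : ∀ (f : ℕ → Poly) N → sum1 (λ m → f (suc N ∸ m)) N ≋ sum1 f N
sum1-reverse f zero    = ≋-refl
sum1-reverse f (suc N) = begin
  sum1 (λ m → f (2 ℕ.+ N ∸ m)) N +ₚ f (2 ℕ.+ N ∸ suc N)
    ≈⟨ +ₚ-cong (sum1-cong N (λ m _ m≤N → ≡⇒≋ (cong f (ℕ.+-∸-assoc 1 (ℕ.m≤n⇒m≤1+n m≤N)))))
               (≡⇒≋ (cong f (ℕ.m+n∸n≡m 1 N))) ⟩
  sum1 (λ m → f (suc (suc N ∸ m))) N +ₚ f 1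
    ≈⟨ +ₚ-cong (sum1-reverse (λ m → f (suc m)) N) ≋-refl ⟩
  sum1 (λ m → f (suc m)) N +ₚ f 1
    ≈⟨ +ₚ-comm _ (f 1) ⟩
  f 1 +ₚ sum1 (λ m → f (suc m)) N
    ≈⟨ sum1-unconsˡ f N ⟨
  sum1 f (suc N)
    ∎
  where open ≋-Reasoning

-- q-integers and geometric sums

q*ₚ : ∀ f → qₚ *ₚ f ≋ 0ℚ ∷ f
q*ₚ f = ≋-trans (+ₚ-cong (0·ₚ f) (∷-cong refl (*ₚ-identityˡ f))) ≋-refl

∷≋const+q* : ∀ a f → a ∷ f ≋ constₚ a +ₚ qₚ *ₚ f
∷≋const+q* a f = ≋-sym (≋-trans (+ₚ-cong (≋-refl {constₚ a}) (q*ₚ f)) (∷-cong (ℚ.+-identityʳ a) ≋-refl))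

^ₚ-+ : ∀ f a b → f ^ₚ (a ℕ.+ b) ≋ (f ^ₚ a) *ₚ (f ^ₚ b)
^ₚ-+ f zero    b = ≋-sym (*ₚ-identityˡ (f ^ₚ b))
^ₚ-+ f (suc a) b = ≋-trans (*ₚ-congʳ f (^ₚ-+ f a b)) (≋-sym (*ₚ-assoc f (f ^ₚ a) (f ^ₚ b)))

[+]q : ∀ m k → [ m ℕ.+ k ]q ≋ [ m ]q +ₚ (qₚ ^ₚ m) *ₚ [ k ]q
[+]q zero    k = ≋-sym (*ₚ-identityˡ [ k ]q)
[+]q (suc m) k = begin
  1ℚ ∷ [ m ℕ.+ k ]q
    ≈⟨ ∷≋const+q* 1ℚ [ m ℕ.+ k ]q ⟩
  oneₚ +ₚ qₚ *ₚ [ m ℕ.+ k ]q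
    ≈⟨ +ₚ-cong (≋-refl {oneₚ}) (*ₚ-congʳ qₚ ([+]q m k)) ⟩
  oneₚ +ₚ qₚ *ₚ ([ m ]q +ₚ (qₚ ^ₚ m) *ₚ [ k ]q)
    ≈⟨ solve 4 (λ q u Q v → con 1ℚ :+ q :* (u :+ Q :* v) := (con 1ℚ :+ q :* u) :+ (q :* Q) :* v)
         ≋-refl qₚ [ m ]q (qₚ ^ₚ m) [ k ]q ⟩
  (oneₚ +ₚ qₚ *ₚ [ m ]q) +ₚ (qₚ ^ₚ suc m) *ₚ [ k ]q
    ≈⟨ +ₚ-cong (∷≋const+q* 1ℚ [ m ]q) ≋-refl ⟨
  [ suc m ]q +ₚ (qₚ ^ₚ suc m) *ₚ [ k ]q
    ∎
  where open ≋-Reasoning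

1-q*[]q : ∀ m → (oneₚ -ₚ qₚ) *ₚ [ m ]q ≋ oneₚ -ₚ qₚ ^ₚ m
1-q*[]q zero    = ≋-trans (*ₚ-zeroʳ (oneₚ -ₚ qₚ)) (≋-sym (-ₚ‿inverseʳ oneₚ))
1-q*[]q (suc m) = begin
  (oneₚ -ₚ qₚ) *ₚ (1ℚ ∷ [ m ]q)
    ≈⟨ *ₚ-congʳ (oneₚ -ₚ qₚ) (∷≋const+q* 1ℚ [ m ]q) ⟩
  (oneₚ -ₚ qₚ) *ₚ (oneₚ +ₚ qₚ *ₚ [ m ]q)
    ≈⟨ solve 2 (λ q u → (con 1ℚ :- q) :* (con 1ℚ :+ q :* u) := (con 1ℚ :- q) :+ q :* ((con 1ℚ :- q) :* u))
         ≋-refl qₚ [ m ]q ⟩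
  (oneₚ -ₚ qₚ) +ₚ qₚ *ₚ ((oneₚ -ₚ qₚ) *ₚ [ m ]q)
    ≈⟨ +ₚ-cong (≋-refl {oneₚ -ₚ qₚ}) (*ₚ-congʳ qₚ (1-q*[]q m)) ⟩
  (oneₚ -ₚ qₚ) +ₚ qₚ *ₚ (oneₚ -ₚ qₚ ^ₚ m)
    ≈⟨ solve 2 (λ q Q → (con 1ℚ :- q) :+ q :* (con 1ℚ :- Q) := con 1ℚ :- q :* Q) ≋-refl qₚ (qₚ ^ₚ m) ⟩
  oneₚ -ₚ qₚ ^ₚ suc m
    ∎
  where open ≋-Reasoning

geometric-tail : Poly → Poly → ℕ → Poly
geometric-tail a b L = sum1 (λ l → (a ^ₚ l) *ₚ (b ^ₚ suc l)) L

geometric-sum : ∀ a b L →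
  (oneₚ -ₚ a *ₚ b) *ₚ (b +ₚ geometric-tail a b L) ≋ b -ₚ (a ^ₚ suc L) *ₚ (b ^ₚ suc (suc L))
geometric-sum a b zero    = begin
  (oneₚ -ₚ a *ₚ b) *ₚ (b +ₚ [])
    ≈⟨ *ₚ-congʳ (oneₚ -ₚ a *ₚ b) (+ₚ-identityʳ b) ⟩
  (oneₚ -ₚ a *ₚ b) *ₚ b
    ≈⟨ solve 2 (λ a b → (con 1ℚ :- a :* b) :* b := b :- (a :* con 1ℚ) :* (b :* (b :* con 1ℚ))) ≋-refl a b ⟩
  b -ₚ (a ^ₚ 1) *ₚ (b ^ₚ 2)
    ∎
  where open ≋-Reasoning
geometric-sum a b (suc L) = begin
  (oneₚ -ₚ a *ₚ b) *ₚ (b +ₚ (S +ₚ A *ₚ B))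
    ≈⟨ solve 5 (λ a b S A B → (con 1ℚ :- a :* b) :* (b :+ (S :+ A :* B))
                           := (con 1ℚ :- a :* b) :* (b :+ S) :+ (con 1ℚ :- a :* b) :* (A :* B))
         ≋-refl a b S A B ⟩
  (oneₚ -ₚ a *ₚ b) *ₚ (b +ₚ S) +ₚ (oneₚ -ₚ a *ₚ b) *ₚ (A *ₚ B)
    ≈⟨ +ₚ-cong (geometric-sum a b L) ≋-refl ⟩
  b -ₚ A *ₚ B +ₚ (oneₚ -ₚ a *ₚ b) *ₚ (A *ₚ B)
    ≈⟨ solve 4 (λ a b A B → b :- A :* B :+ (con 1ℚ :- a :* b) :* (A :* B) := b :- (a :* A) :* (b :* B))
         ≋-refl a b A B ⟩
  b -ₚ (a *ₚ A) *ₚ (b *ₚ B)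
    ∎
  where
  open ≋-Reasoning
  S = geometric-tail a b L
  A = a ^ₚ suc L
  B = b ^ₚ suc (suc L)

-- Symmetrising ζ(1)

reflection-defect : (p L : ℕ) → (ℕ → Poly) → ℕ → Poly
reflection-defect p L inv m =
  inv m +ₚ inv (p ∸ m) -ₚ (oneₚ -ₚ qₚ) +ₚ (qₚ ^ₚ m) *ₚ geometric-tail [ p ]q (inv m) L

ζ₁≋sum1 : ∀ p inv → ζₚ p 1 inv ≋ sum1 inv (p ∸ 1)
ζ₁≋sum1 p inv = sum1-cong (p ∸ 1) (λ m _ _ → ≋-trans (*ₚ-identityˡ (inv m *ₚ oneₚ)) (*ₚ-identityʳ (inv m)))

tailSum≋sum1 : ∀ p L inv → tailSumₚ p L inv ≋ sum1 (λ m → (qₚ ^ₚ m) *ₚ geometric-tail [ p ]q (inv m) L) (p ∸ 1)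
tailSum≋sum1 p L inv = begin
  sum1 (λ l → [ p ]q ^ₚ l *ₚ sum1 (λ m → (qₚ ^ₚ m) *ₚ (inv m ^ₚ suc l)) (p ∸ 1)) L
    ≈⟨ sum1-cong L (λ l _ _ → ≋-sym (sum1-*ˡ ([ p ]q ^ₚ l) (λ m → (qₚ ^ₚ m) *ₚ (inv m ^ₚ suc l)) (p ∸ 1))) ⟩
  sum1 (λ l → sum1 (λ m → [ p ]q ^ₚ l *ₚ ((qₚ ^ₚ m) *ₚ (inv m ^ₚ suc l))) (p ∸ 1)) L
    ≈⟨ sum1-swap (λ l m → [ p ]q ^ₚ l *ₚ ((qₚ ^ₚ m) *ₚ (inv m ^ₚ suc l))) L (p ∸ 1) ⟩
  sum1 (λ m → sum1 (λ l → [ p ]q ^ₚ l *ₚ ((qₚ ^ₚ m) *ₚ (inv m ^ₚ suc l))) L) (p ∸ 1)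
    ≈⟨ sum1-cong (p ∸ 1) (λ m _ _ → sum1-cong L (λ l _ _ →
         solve 3 (λ P Q X → P :* (Q :* X) := Q :* (P :* X)) ≋-refl ([ p ]q ^ₚ l) (qₚ ^ₚ m) (inv m ^ₚ suc l))) ⟩
  sum1 (λ m → sum1 (λ l → (qₚ ^ₚ m) *ₚ ([ p ]q ^ₚ l *ₚ (inv m ^ₚ suc l))) L) (p ∸ 1)
    ≈⟨ sum1-cong (p ∸ 1) (λ m _ _ → sum1-*ˡ (qₚ ^ₚ m) (λ l → [ p ]q ^ₚ l *ₚ (inv m ^ₚ suc l)) L) ⟩
  sum1 (λ m → (qₚ ^ₚ m) *ₚ geometric-tail [ p ]q (inv m) L) (p ∸ 1)
    ∎
  where open ≋-Reasoning

factor-out-½ : ∀ z c w t → z -ₚ (c ℚ.* ½) ·ₚ w +ₚ ½ ·ₚ t ≋ constₚ ½ *ₚ ((z +ₚ z) +ₚ c ·ₚ (-ₚ w) +ₚ t)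
factor-out-½ z c w t = begin
  z -ₚ (c ℚ.* ½) ·ₚ w +ₚ ½ ·ₚ t
    ≈⟨ +ₚ-cong (+ₚ-cong (≋-refl {z}) (-ₚ‿cong (≋-trans (·ₚ≋const*ₚ (c ℚ.* ½) w) (*ₚ-congˡ w (const-* c ½)))))
               (·ₚ≋const*ₚ ½ t) ⟩
  z -ₚ (constₚ c *ₚ constₚ ½) *ₚ w +ₚ constₚ ½ *ₚ t
    ≈⟨ solve 4 (λ z C w t → z :- (C :* con ½) :* w :+ con ½ :* t := con ½ :* ((z :+ z) :+ C :* (:- w) :+ t))
         ≋-refl z (constₚ c) w t ⟩
  constₚ ½ *ₚ ((z +ₚ z) +ₚ constₚ c *ₚ (-ₚ w) +ₚ t)
    ≈⟨ *ₚ-congʳ (constₚ ½) (+ₚ-cong (+ₚ-cong (≋-refl {z +ₚ z}) (·ₚ≋const*ₚ c (-ₚ w))) (≋-refl {t})) ⟨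
  constₚ ½ *ₚ ((z +ₚ z) +ₚ c ·ₚ (-ₚ w) +ₚ t)
    ∎
  where open ≋-Reasoning

LHS≋½sum1 : ∀ N L inv → LHSₚ (suc N) L inv ≋ constₚ ½ *ₚ sum1 (reflection-defect (suc N) L inv) N
LHS≋½sum1 N L inv = begin
  ζ -ₚ (ℕ→ℚ N ℚ.* ½) ·ₚ W +ₚ ½ ·ₚ t
    ≈⟨ factor-out-½ ζ (ℕ→ℚ N) W t ⟩
  constₚ ½ *ₚ ((ζ +ₚ ζ) +ₚ ℕ→ℚ N ·ₚ (-ₚ W) +ₚ t)
    ≈⟨ *ₚ-congʳ (constₚ ½) (+ₚ-cong (+ₚ-cong (+ₚ-cong ζ≋Σx ζ≋Σy) (≋-sym (sum1-const (-ₚ W) N)))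
                                     (tailSum≋sum1 (suc N) L inv)) ⟩
  constₚ ½ *ₚ ((sum1 x N +ₚ sum1 y N) +ₚ sum1 (λ _ → -ₚ W) N +ₚ sum1 QS N)
    ≈⟨ *ₚ-congʳ (constₚ ½) (≋-trans (sum1-+ _ QS N) (+ₚ-cong (≋-trans (sum1-+ _ (λ _ → -ₚ W) N)
                              (+ₚ-cong (sum1-+ x y N) ≋-refl)) ≋-refl)) ⟨
  constₚ ½ *ₚ sum1 (reflection-defect (suc N) L inv) N
    ∎
  where
  open ≋-Reasoning
  ζ = ζₚ (suc N) 1 inv
  t = tailSumₚ (suc N) L inv
  W = oneₚ -ₚ qₚ
  x = inv
  y = λ m → inv (suc N ∸ m)
  QS = λ m → (qₚ ^ₚ m) *ₚ geometric-tail [ suc N ]q (inv m) L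
  ζ≋Σx : ζ ≋ sum1 x N
  ζ≋Σx = ζ₁≋sum1 (suc N) inv
  ζ≋Σy : ζ ≋ sum1 y N
  ζ≋Σy = ≋-trans ζ≋Σx (≋-sym (sum1-reverse inv N))

-- Congruences modulo [p]ⁿ in ℤ₍ₚ₎[q]

module Z₍ₚ₎[q] {p : ℕ} (p-prime : Prime p) where

  -- InZ₍ₚ₎[q] p, and below CongZ p n, repackaged as records for the same reason as _≋_.
  record Integral (f : Poly) : Set where
    constructor integral
    field coeff-InZ₍ₚ₎ : InZ₍ₚ₎[q] p f
  open Integral

  integral-[] : Integral []
  integral-[] = integral λ _ → p∤1 p-prime

  integral-∷ : ∀ {a f} → InZ₍ₚ₎ p a → Integral f → Integral (a ∷ f)
  integral-∷ za (integral zf) = integral λ { zero → za ; (suc i) → zf i }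

  integral-head : ∀ {a f} → Integral (a ∷ f) → InZ₍ₚ₎ p a
  integral-head (integral z) = z zero

  integral-tail : ∀ {a f} → Integral (a ∷ f) → Integral f
  integral-tail (integral z) = integral λ i → z (suc i)

  integral-+ : ∀ {f g} → Integral f → Integral g → Integral (f +ₚ g)
  integral-+ {f} {g} (integral zf) (integral zg) = integral λ i →
    subst (InZ₍ₚ₎ p) (sym (coeff-+ₚ f g i)) (InZ₍ₚ₎-+ p-prime {coeff f i} {coeff g i} (zf i) (zg i))

  integral-· : ∀ {c f} → InZ₍ₚ₎ p c → Integral f → Integral (c ·ₚ f)
  integral-· {c} {f} zc (integral zf) = integral λ i →
    subst (InZ₍ₚ₎ p) (sym (coeff-·ₚ c f i)) (InZ₍ₚ₎-* p-prime {c} {coeff f i} zc (zf i))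

  integral-neg : ∀ {f} → Integral f → Integral (-ₚ f)
  integral-neg = integral-· (p∤1 p-prime)

  integral-* : ∀ {f g} → Integral f → Integral g → Integral (f *ₚ g)
  integral-* {[]}    zf zg = integral-[]
  integral-* {a ∷ f} zf zg =
    integral-+ (integral-· (integral-head zf) zg) (integral-∷ (p∤1 p-prime) (integral-* (integral-tail zf) zg))

  integral-one : Integral oneₚ
  integral-one = integral-∷ (p∤1 p-prime) integral-[]

  integral-q : Integral qₚ
  integral-q = integral-∷ (p∤1 p-prime) integral-one

  integral-^ : ∀ {f} k → Integral f → Integral (f ^ₚ k)
  integral-^ zero    zf = integral-one
  integral-^ (suc k) zf = integral-* zf (integral-^ k zf)

  integral-[]q : ∀ m → Integral [ m ]q
  integral-[]q zero    = integral-[]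
  integral-[]q (suc m) = integral-∷ (p∤1 p-prime) (integral-[]q m)

  integral-sum1 : ∀ {f : ℕ → Poly} N → (∀ m → Integral (f m)) → Integral (sum1 f N)
  integral-sum1 zero    zf = integral-[]
  integral-sum1 (suc N) zf = integral-+ (integral-sum1 N zf) (zf (suc N))

  module Mod[p]ⁿ (n : ℕ) where

    private
      Pⁿ : Poly
      Pⁿ = [ p ]q ^ₚ n

    infix 4 _≡[mod[p]ⁿ]_
    record _≡[mod[p]ⁿ]_ (f g : Poly) : Set where
      constructor mod[p]ⁿ
      field
        {quotient}        : Poly
        integral-quotient : Integral quotient
        difference        : f -ₚ g ≋ Pⁿ *ₚ quotient

    CongZ⇒≡[mod[p]ⁿ] : ∀ {f g} → CongZ p n f g → f ≡[mod[p]ⁿ] g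
    CongZ⇒≡[mod[p]ⁿ] (c , zc , e) = mod[p]ⁿ (integral zc) (mk≋ e)

    ≡[mod[p]ⁿ]⇒CongZ : ∀ {f g} → f ≡[mod[p]ⁿ] g → CongZ p n f g
    ≡[mod[p]ⁿ]⇒CongZ (mod[p]ⁿ zc e) = _ , coeff-InZ₍ₚ₎ zc , coeff-≡ e

    ≋⇒≡[mod[p]ⁿ] : ∀ {f g} → f ≋ g → f ≡[mod[p]ⁿ] g
    ≋⇒≡[mod[p]ⁿ] {f} {g} f≋g = mod[p]ⁿ integral-[] (begin
      f -ₚ g     ≈⟨ +ₚ-cong f≋g ≋-refl ⟩
      g -ₚ g     ≈⟨ -ₚ‿inverseʳ g ⟩
      []         ≈⟨ *ₚ-zeroʳ Pⁿ ⟨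
      Pⁿ *ₚ []   ∎)
      where open ≋-Reasoning

    ≡[mod[p]ⁿ]-refl : ∀ {f} → f ≡[mod[p]ⁿ] f
    ≡[mod[p]ⁿ]-refl = ≋⇒≡[mod[p]ⁿ] ≋-refl

    ≡[mod[p]ⁿ]-sym : ∀ {f g} → f ≡[mod[p]ⁿ] g → g ≡[mod[p]ⁿ] f
    ≡[mod[p]ⁿ]-sym {f} {g} (mod[p]ⁿ {c} zc e) = mod[p]ⁿ (integral-neg zc) (begin
      g -ₚ f          ≈⟨ solve 2 (λ f g → g :- f := :- (f :- g)) ≋-refl f g ⟩
      -ₚ (f -ₚ g)     ≈⟨ -ₚ‿cong e ⟩
      -ₚ (Pⁿ *ₚ c)    ≈⟨ solve 2 (λ P c → :- (P :* c) := P :* (:- c)) ≋-refl Pⁿ c ⟩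
      Pⁿ *ₚ (-ₚ c)    ∎)
      where open ≋-Reasoning

    ≡[mod[p]ⁿ]-neg : ∀ {f g} → f ≡[mod[p]ⁿ] g → -ₚ f ≡[mod[p]ⁿ] -ₚ g
    ≡[mod[p]ⁿ]-neg {f} {g} (mod[p]ⁿ {c} zc e) = mod[p]ⁿ (integral-neg zc) (begin
      -ₚ f -ₚ -ₚ g    ≈⟨ solve 2 (λ f g → :- f :- :- g := :- (f :- g)) ≋-refl f g ⟩
      -ₚ (f -ₚ g)     ≈⟨ -ₚ‿cong e ⟩
      -ₚ (Pⁿ *ₚ c)    ≈⟨ solve 2 (λ P c → :- (P :* c) := P :* (:- c)) ≋-refl Pⁿ c ⟩
      Pⁿ *ₚ (-ₚ c)    ∎)
      where open ≋-Reasoning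

    ≡[mod[p]ⁿ]-+ : ∀ {f f′ g g′} → f ≡[mod[p]ⁿ] f′ → g ≡[mod[p]ⁿ] g′ →
                   f +ₚ g ≡[mod[p]ⁿ] f′ +ₚ g′
    ≡[mod[p]ⁿ]-+ {f} {f′} {g} {g′} (mod[p]ⁿ {c} zc e) (mod[p]ⁿ {d} zd e′) = mod[p]ⁿ (integral-+ zc zd) (begin
      (f +ₚ g) -ₚ (f′ +ₚ g′)     ≈⟨ solve 4 (λ f f′ g g′ → (f :+ g) :- (f′ :+ g′) := (f :- f′) :+ (g :- g′))
                                     ≋-refl f f′ g g′ ⟩
      (f -ₚ f′) +ₚ (g -ₚ g′)     ≈⟨ +ₚ-cong e e′ ⟩
      Pⁿ *ₚ c +ₚ Pⁿ *ₚ d         ≈⟨ *ₚ-distribˡ Pⁿ c d ⟨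
      Pⁿ *ₚ (c +ₚ d)             ∎)
      where open ≋-Reasoning

    ≡[mod[p]ⁿ]-trans : ∀ {f g h} → f ≡[mod[p]ⁿ] g → g ≡[mod[p]ⁿ] h → f ≡[mod[p]ⁿ] h
    ≡[mod[p]ⁿ]-trans {f} {g} {h} (mod[p]ⁿ {c} zc e) (mod[p]ⁿ {d} zd e′) = mod[p]ⁿ (integral-+ zc zd) (begin
      f -ₚ h                   ≈⟨ solve 3 (λ f g h → f :- h := (f :- g) :+ (g :- h)) ≋-refl f g h ⟩
      (f -ₚ g) +ₚ (g -ₚ h)     ≈⟨ +ₚ-cong e e′ ⟩
      Pⁿ *ₚ c +ₚ Pⁿ *ₚ d       ≈⟨ *ₚ-distribˡ Pⁿ c d ⟨
      Pⁿ *ₚ (c +ₚ d)           ∎)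
      where open ≋-Reasoning

    ≡[mod[p]ⁿ]-*ˡ : ∀ {h f g} → Integral h → f ≡[mod[p]ⁿ] g → h *ₚ f ≡[mod[p]ⁿ] h *ₚ g
    ≡[mod[p]ⁿ]-*ˡ {h} {f} {g} zh (mod[p]ⁿ {c} zc e) = mod[p]ⁿ (integral-* zh zc) (begin
      h *ₚ f -ₚ h *ₚ g     ≈⟨ solve 3 (λ h f g → h :* f :- h :* g := h :* (f :- g)) ≋-refl h f g ⟩
      h *ₚ (f -ₚ g)        ≈⟨ *ₚ-congʳ h e ⟩
      h *ₚ (Pⁿ *ₚ c)       ≈⟨ solve 3 (λ h P c → h :* (P :* c) := P :* (h :* c)) ≋-refl h Pⁿ c ⟩
      Pⁿ *ₚ (h *ₚ c)       ∎)
      where open ≋-Reasoning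

    [p]ⁿ*≡0 : ∀ {c} → Integral c → Pⁿ *ₚ c ≡[mod[p]ⁿ] []
    [p]ⁿ*≡0 zc = mod[p]ⁿ zc (+ₚ-identityʳ _)

    ≡[mod[p]ⁿ]-setoid : Setoid _ _
    ≡[mod[p]ⁿ]-setoid = record
      { Carrier = Poly
      ; _≈_ = _≡[mod[p]ⁿ]_
      ; isEquivalence = record
        { refl = ≡[mod[p]ⁿ]-refl ; sym = ≡[mod[p]ⁿ]-sym ; trans = ≡[mod[p]ⁿ]-trans } }

    module ≡[mod[p]ⁿ]-Reasoning = Relation.Binary.Reasoning.Setoid ≡[mod[p]ⁿ]-setoid

    sum1-≡0 : ∀ {f : ℕ → Poly} N → (∀ m → 1 ≤ m → m ≤ N → f m ≡[mod[p]ⁿ] []) → sum1 f N ≡[mod[p]ⁿ] []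
    sum1-≡0 zero    f≡0 = ≡[mod[p]ⁿ]-refl
    sum1-≡0 (suc N) f≡0 =
      ≡[mod[p]ⁿ]-+ (sum1-≡0 N (λ m 1≤m m≤N → f≡0 m 1≤m (ℕ.m≤n⇒m≤1+n m≤N)))
                   (f≡0 (suc N) (s≤s z≤n) ℕ.≤-refl)

    truncated-geometric-sum : ∀ {b} L → n ≤ suc L → Integral b →
      (oneₚ -ₚ [ p ]q *ₚ b) *ₚ (b +ₚ geometric-tail [ p ]q b L) ≡[mod[p]ⁿ] b
    truncated-geometric-sum {b} L n≤1+L zb = begin
      (oneₚ -ₚ [ p ]q *ₚ b) *ₚ (b +ₚ geometric-tail [ p ]q b L)
        ≈⟨ ≋⇒≡[mod[p]ⁿ] (geometric-sum [ p ]q b L) ⟩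
      b -ₚ ([ p ]q ^ₚ suc L) *ₚ B
        ≈⟨ ≋⇒≡[mod[p]ⁿ] (+ₚ-cong (≋-refl {b}) (-ₚ‿cong (*ₚ-congˡ B [p]ᴸ⁺¹≋[p]ⁿ*))) ⟩
      b -ₚ (Pⁿ *ₚ [ p ]q ^ₚ (suc L ∸ n)) *ₚ B
        ≈⟨ ≡[mod[p]ⁿ]-+ (≡[mod[p]ⁿ]-refl {b}) (≡[mod[p]ⁿ]-neg (≡[mod[p]ⁿ]-trans
             (≋⇒≡[mod[p]ⁿ] (*ₚ-assoc Pⁿ _ B)) ([p]ⁿ*≡0 (integral-* (integral-^ (suc L ∸ n) (integral-[]q p)) zB)))) ⟩
      b -ₚ []
        ≈⟨ ≋⇒≡[mod[p]ⁿ] (+ₚ-identityʳ b) ⟩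
      b ∎
      where
      open ≡[mod[p]ⁿ]-Reasoning
      B = b ^ₚ suc (suc L)
      zB = integral-^ (suc (suc L)) zb
      [p]ᴸ⁺¹≋[p]ⁿ* : [ p ]q ^ₚ suc L ≋ Pⁿ *ₚ [ p ]q ^ₚ (suc L ∸ n)
      [p]ᴸ⁺¹≋[p]ⁿ* = ≋-trans (≡⇒≋ (cong ([ p ]q ^ₚ_) (sym (ℕ.m+[n∸m]≡n n≤1+L))))
                             (^ₚ-+ [ p ]q n (suc L ∸ n))

    inverse-of-complement : ∀ {P Q u v x y S} →
      Integral x → Integral y → Integral u → Integral v → Integral Q → Integral S →
      x *ₚ u ≡[mod[p]ⁿ] oneₚ → y *ₚ v ≡[mod[p]ⁿ] oneₚ → P ≋ u +ₚ Q *ₚ v →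
      (oneₚ -ₚ P *ₚ x) *ₚ (x +ₚ S) ≡[mod[p]ⁿ] x →
      y ≡[mod[p]ⁿ] -ₚ (Q *ₚ (x +ₚ S))
    inverse-of-complement {P} {Q} {u} {v} {x} {y} {S} zx zy zu zv zQ zS xu≡1 yv≡1 P≋u+Qv geometric = begin
      y
        ≈⟨ ≋⇒≡[mod[p]ⁿ] (*ₚ-identityʳ y) ⟨
      y *ₚ oneₚ
        ≈⟨ ≡[mod[p]ⁿ]-*ˡ zy xu≡1 ⟨
      y *ₚ (x *ₚ u)
        ≈⟨ ≋⇒≡[mod[p]ⁿ] (solve 3 (λ y x u → y :* (x :* u) := (y :* u) :* x) ≋-refl y x u) ⟩
      (y *ₚ u) *ₚ x
        ≈⟨ ≡[mod[p]ⁿ]-*ˡ (integral-* zy zu) geometric ⟨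
      (y *ₚ u) *ₚ ((oneₚ -ₚ P *ₚ x) *ₚ (x +ₚ S))
        ≈⟨ ≋⇒≡[mod[p]ⁿ] (*ₚ-congʳ (y *ₚ u) (*ₚ-congˡ (x +ₚ S)
             (+ₚ-cong (≋-refl {oneₚ}) (-ₚ‿cong (*ₚ-congˡ x P≋u+Qv))))) ⟩
      (y *ₚ u) *ₚ ((oneₚ -ₚ (u +ₚ Q *ₚ v) *ₚ x) *ₚ (x +ₚ S))
        ≈⟨ ≋⇒≡[mod[p]ⁿ] (solve 6 (λ y u Q v x S →
             (y :* u) :* ((con 1ℚ :- (u :+ Q :* v) :* x) :* (x :+ S))
          := (y :* u) :* (x :+ S) :* (con 1ℚ :- x :* u) :- Q :* (x :+ S) :* ((y :* v) :* (x :* u)))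
             ≋-refl y u Q v x S) ⟩
      (y *ₚ u) *ₚ (x +ₚ S) *ₚ (oneₚ -ₚ x *ₚ u) -ₚ Q *ₚ (x +ₚ S) *ₚ ((y *ₚ v) *ₚ (x *ₚ u))
        ≈⟨ ≡[mod[p]ⁿ]-+ (≡[mod[p]ⁿ]-*ˡ yu[x+S] (≡[mod[p]ⁿ]-+ (≡[mod[p]ⁿ]-refl {oneₚ}) (≡[mod[p]ⁿ]-neg xu≡1)))
                        (≡[mod[p]ⁿ]-neg (≡[mod[p]ⁿ]-*ˡ Q[x+S] yv·xu≡1)) ⟩
      (y *ₚ u) *ₚ (x +ₚ S) *ₚ (oneₚ -ₚ oneₚ) -ₚ Q *ₚ (x +ₚ S) *ₚ oneₚ
        ≈⟨ ≋⇒≡[mod[p]ⁿ] (solve 5 (λ y u x S Q →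
             (y :* u) :* (x :+ S) :* (con 1ℚ :- con 1ℚ) :- Q :* (x :+ S) :* con 1ℚ := :- (Q :* (x :+ S)))
             ≋-refl y u x S Q) ⟩
      -ₚ (Q *ₚ (x +ₚ S))
        ∎
      where
      open ≡[mod[p]ⁿ]-Reasoning
      yu[x+S] = integral-* (integral-* zy zu) (integral-+ zx zS)
      Q[x+S]  = integral-* zQ (integral-+ zx zS)
      yv·xu≡1 : (y *ₚ v) *ₚ (x *ₚ u) ≡[mod[p]ⁿ] oneₚ
      yv·xu≡1 = ≡[mod[p]ⁿ]-trans (≡[mod[p]ⁿ]-*ˡ (integral-* zy zv) xu≡1)
                  (≡[mod[p]ⁿ]-trans (≋⇒≡[mod[p]ⁿ] (*ₚ-identityʳ (y *ₚ v))) yv≡1)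

    reflection-congruence : ∀ {P Q u v w x y S} →
      Integral x → Integral y → Integral u → Integral v → Integral w → Integral Q → Integral S →
      x *ₚ u ≡[mod[p]ⁿ] oneₚ → y *ₚ v ≡[mod[p]ⁿ] oneₚ → P ≋ u +ₚ Q *ₚ v → w *ₚ u ≋ oneₚ -ₚ Q →
      (oneₚ -ₚ P *ₚ x) *ₚ (x +ₚ S) ≡[mod[p]ⁿ] x →
      x +ₚ y -ₚ w +ₚ Q *ₚ S ≡[mod[p]ⁿ] []
    reflection-congruence {P} {Q} {u} {v} {w} {x} {y} {S} zx zy zu zv zw zQ zS xu≡1 yv≡1 P≋u+Qv wu≋1-Q geometric = begin
      x +ₚ y -ₚ w +ₚ Q *ₚ S
        ≈⟨ ≡[mod[p]ⁿ]-+ (≡[mod[p]ⁿ]-+ (≡[mod[p]ⁿ]-+ (≡[mod[p]ⁿ]-refl {x})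
             (inverse-of-complement zx zy zu zv zQ zS xu≡1 yv≡1 P≋u+Qv geometric))
             (≡[mod[p]ⁿ]-refl { -ₚ w})) (≡[mod[p]ⁿ]-refl {Q *ₚ S}) ⟩
      x -ₚ Q *ₚ (x +ₚ S) -ₚ w +ₚ Q *ₚ S
        ≈⟨ ≋⇒≡[mod[p]ⁿ] (solve 4 (λ x Q S w → x :- Q :* (x :+ S) :- w :+ Q :* S := x :* (con 1ℚ :- Q) :- w)
             ≋-refl x Q S w) ⟩
      x *ₚ (oneₚ -ₚ Q) -ₚ w
        ≈⟨ ≋⇒≡[mod[p]ⁿ] (+ₚ-cong (*ₚ-congʳ x (≋-sym wu≋1-Q)) (≋-refl { -ₚ w})) ⟩
      x *ₚ (w *ₚ u) -ₚ w
        ≈⟨ ≋⇒≡[mod[p]ⁿ] (solve 3 (λ x w u → x :* (w :* u) :- w := w :* (x :* u) :- w) ≋-refl x w u) ⟩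
      w *ₚ (x *ₚ u) -ₚ w
        ≈⟨ ≡[mod[p]ⁿ]-+ (≡[mod[p]ⁿ]-*ˡ zw xu≡1) (≡[mod[p]ⁿ]-refl { -ₚ w}) ⟩
      w *ₚ oneₚ -ₚ w
        ≈⟨ ≋⇒≡[mod[p]ⁿ] (≋-trans (+ₚ-cong (*ₚ-identityʳ w) (≋-refl { -ₚ w})) (-ₚ‿inverseʳ w)) ⟩
      []  ∎
      where open ≡[mod[p]ⁿ]-Reasoning

    reflection-defect≡0 : ∀ inv → IsInvFamily p n inv → ∀ L → n ≤ L →
                          ∀ m → 1 ≤ m → m < p → reflection-defect p L inv m ≡[mod[p]ⁿ] []
    reflection-defect≡0 inv inv-family L n≤L m 1≤m m<p =
      reflection-congruence zx zy (integral-[]q m) (integral-[]q (p ∸ m))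
        (integral-+ integral-one (integral-neg integral-q)) (integral-^ m integral-q) zS
        (inverse m 1≤m m<p) (inverse (p ∸ m) 1≤p∸m p∸m<p)
        (≋-trans (≡⇒≋ (cong [_]q (sym (ℕ.m+[n∸m]≡n (ℕ.<⇒≤ m<p))))) ([+]q m (p ∸ m)))
        (1-q*[]q m)
        (truncated-geometric-sum L (ℕ.m≤n⇒m≤1+n n≤L) zx)
      where
      integral-inv : ∀ k → 1 ≤ k → k < p → Integral (inv k)
      integral-inv k 1≤k k<p = integral (proj₁ (inv-family k 1≤k k<p))
      inverse : ∀ k → 1 ≤ k → k < p → inv k *ₚ [ k ]q ≡[mod[p]ⁿ] oneₚ
      inverse k 1≤k k<p = CongZ⇒≡[mod[p]ⁿ] (proj₂ (inv-family k 1≤k k<p))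
      1≤p∸m : 1 ≤ p ∸ m
      1≤p∸m = ℕ.m<n⇒0<n∸m m<p
      p∸m<p : p ∸ m < p
      p∸m<p = ℕ.∸-monoʳ-< {p} {m} {0} 1≤m (ℕ.<⇒≤ m<p)
      zx = integral-inv m 1≤m m<p
      zy = integral-inv (p ∸ m) 1≤p∸m p∸m<p
      zS = integral-sum1 L (λ l → integral-* (integral-^ l (integral-[]q p)) (integral-^ (suc l) zx))

-- The bound N = 2 excludes p = 2, for which ½ is not 2-integral.
proposition4p6 : ∀ (n : ℕ) → ∃ λ (N : ℕ) →
    ∀ (p : ℕ) → Prime p → N < p →
    ∀ (inv : ℕ → Poly) → IsInvFamily p n inv →
    ∀ (L : ℕ) → n ≤ L →
    CongZ p n (LHSₚ p L inv) zeroₚ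
proposition4p6 n = 2 , LHS≡0
  where
  LHS≡0 : ∀ p → Prime p → 2 < p →
          ∀ inv → IsInvFamily p n inv → ∀ L → n ≤ L → CongZ p n (LHSₚ p L inv) zeroₚ
  LHS≡0 (suc N) p-prime 2<p inv inv-family L n≤L = ≡[mod[p]ⁿ]⇒CongZ (begin
    LHSₚ (suc N) L inv
      ≈⟨ ≋⇒≡[mod[p]ⁿ] (LHS≋½sum1 N L inv) ⟩
    constₚ ½ *ₚ sum1 (reflection-defect (suc N) L inv) N
      ≈⟨ ≡[mod[p]ⁿ]-*ˡ (integral-∷ (InZ₍ₚ₎-½ 2<p) integral-[])
           (sum1-≡0 N (λ m 1≤m m≤N → reflection-defect≡0 inv inv-family L n≤L m 1≤m (s≤s m≤N))) ⟩
    constₚ ½ *ₚ []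
      ≈⟨ ≋⇒≡[mod[p]ⁿ] (*ₚ-zeroʳ (constₚ ½)) ⟩
    [] ∎)
    where
    open Z₍ₚ₎[q] p-prime
    open Mod[p]ⁿ n
    open ≡[mod[p]ⁿ]-Reasoning
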